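{- Let $n,p$ be positive integers with $p\le n/2$. Every nondeterministic OBDD (NOBDD) computing $\mathtt{MOD}^p_n$ has width at least $p$.
   Context: $\mathtt{MOD}^p_n:\{0,1\}^n\to\{0,1\}$ equals 1 iff the number of ones in the input is congruent to $0$ modulo $p$. An OBDD on variables $x_1,\dots,x_n$ is a directed acyclic graph with one source whose nodes are partitioned into levels $V_0,\dots,V_\ell$; nodes of $V_\ell$ are accepting or rejecting sinks; all nodes of $V_j$ ($j<\ell$) query the same variable and have edges labelled 0 and 1 only into $V_{j+1}$; each variable is queried at most once on every path. In a nondeterministic OBDD (NOBDD) a node may have several outgoing edges with the same label and an input is accepted iff some consistent path reaches an accepting sink; it computes $f$ if it accepts exactly $f^{ -1}(1)$. The width is $\max_j|V_j|$. -}

module Defs where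

open import Data.Nat using (ℕ; zero; suc; _⊔_)
open import Data.Nat.Divisibility using (_∣_)
open import Data.Fin using (Fin; zero; suc; inject₁; fromℕ)
open import Data.Bool using (Bool; true; false)
open import Data.Product using (Σ; ∃; _×_; _,_)
open import Function using (_∘_)
open import Function.Definitions using (Injective)
open import Relation.Binary.PropositionalEquality using (_≡_)

ones : ∀ {n} → (Fin n → Bool) → ℕ
ones {zero}  x = 0
ones {suc n} x with x zero
... | true  = suc (ones (x ∘ suc))
... | false = ones (x ∘ suc)

MOD : (p n : ℕ) → (Fin n → Bool) → Set
MOD p n x = p ∣ ones x

maxF : ∀ {m} → (Fin m → ℕ) → ℕ
maxF {zero}  f = 0
maxF {suc m} f = f zero ⊔ maxF (f ∘ suc)

-- A (leveled) nondeterministic OBDD on variables x_1..x_n.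
-- Levels V_0 .. V_ℓ; level j has `size j` nodes (indexed by Fin (size j)).
-- Nodes of V_j (j < ℓ) all query variable `var j`; edges go from V_j to V_{j+1}
-- and are labelled by a bit; several (or no) edges with the same label allowed.
record NOBDD (n : ℕ) : Set where
  field
    ℓ      : ℕ
    size   : Fin (suc ℓ) → ℕ
    var    : Fin ℓ → Fin n
    edge   : (j : Fin ℓ) → Fin (size (inject₁ j)) → Bool → Fin (size (suc j)) → Bool
    accept : Fin (size (fromℕ ℓ)) → Bool
    -- one source: V_0 is a single node and every other node has an incoming edge
    source-unique : size zero ≡ 1
    no-other-source : (j : Fin ℓ) (w : Fin (size (suc j))) →
                      ∃ λ v → ∃ λ b → edge j v b w ≡ true
    -- each variable is queried at most once on every path (ordered, read-once)
    read-once : Injective _≡_ _≡_ var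

  width : ℕ
  width = maxF size

  ConsistentPath : (Fin n → Bool) → (π : (j : Fin (suc ℓ)) → Fin (size j)) → Set
  ConsistentPath x π = (j : Fin ℓ) → edge j (π (inject₁ j)) (x (var j)) (π (suc j)) ≡ true

  Accepts : (Fin n → Bool) → Set
  Accepts x = Σ ((j : Fin (suc ℓ)) → Fin (size j)) λ π →
                ConsistentPath x π × accept (π (fromℕ ℓ)) ≡ true

-- B computes f (given as a predicate: f x = 1 iff P x) iff it accepts exactly f⁻¹(1)
open import Function.Bundles using (_⇔_)
Computes : ∀ {n} → NOBDD n → ((Fin n → Bool) → Set) → Set
Computes B P = ∀ x → NOBDD.Accepts B x ⇔ P x

module Submission where

-- A fooling-set argument for the width of NOBDDs computing MOD^p_n.
--
-- Acceptance along a path only inspects the variables queried on the path,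
-- and two accepting paths meeting in a node can be cut and pasted there
-- (`cut-and-paste`).  Two consequences for an NOBDD B computing MOD^p_n,
-- p ≥ 2:
--   * every variable is queried at some level (otherwise the all-zero input
--     and the input with a single one would be accepted together), so B has
--     ℓ ≥ n ≥ 2p levels;
--   * for s, t < p let x_{s,t} be the input whose ones are exactly the
--     variables queried at the levels in [s, p + t); it has p + t − s ones,
--     so x_{s,s} is accepted.  If accepting paths for x_{s,s} and x_{t,t}
--     pass through the same node at level p, cutting and pasting them there
--     gives an accepting path for x_{s,t}, forcing s = t.
-- Hence level p has at least p nodes.  The case p = 1 is the single source.
-- The file first develops counting of ones (pushing a subset forward along an
-- injection, intervals), then the cut-and-paste lemma, then the argument.

open import Defs
open import Data.Bool using (Bool; true; false; _∧_; _∨_; not; if_then_else_)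
open import Data.Empty using (⊥-elim)
open import Data.Fin using (Fin; zero; suc; toℕ; inject₁; fromℕ; fromℕ<; _≟_)
open import Data.Fin.Properties
  using (toℕ-injective; toℕ-fromℕ; toℕ-fromℕ<; toℕ-inject₁; toℕ<n; any?;
         injective⇒≤; suc-injective; 0≢1+n)
open import Data.Nat using (ℕ; zero; suc; _+_; _∸_; _*_; _≤_; _<_; z≤n; s≤s)
open import Data.Nat.Divisibility using (_∣_; divides; ∣⇒≤; _∣0; ∣-refl)
open import Data.Nat.Properties
  using (_≤?_; _<?_; ≤-reflexive; ≤-trans; ≤-antisym; <⇒≤; <⇒≱; ≤⇒≯; ≰⇒>; ≤-pred;
         n≤1+n; m≤m+n; m≤m⊔n; m≤n⊔m; +-suc; +-identityʳ; +-monoʳ-<; +-cancelˡ-≡;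
         +-cancelˡ-≤; m+n∸n≡m; m∸n≤m; m∸n+n≡m; m∸n≡0⇒m≤n)
open import Data.Product using (∃; _,_; proj₁; proj₂)
open import Function using (_∘_)
open import Function.Bundles using (Equivalence)
open import Function.Definitions using (Injective)
open import Relation.Binary.PropositionalEquality
  using (_≡_; _≢_; refl; sym; trans; cong; subst; module ≡-Reasoning)
open import Relation.Nullary using (does; yes; no; contradiction)
open import Relation.Nullary.Decidable using (dec-true; dec-false)

open ≡-Reasoning

bit : Bool → ℕ
bit true  = 1
bit false = 0

ones-cons : ∀ {n} (x : Fin (suc n) → Bool) → ones x ≡ bit (x zero) + ones (x ∘ suc)
ones-cons x with x zero
... | true  = refl
... | false = refl

allFalse : ∀ {n} → Fin n → Bool
allFalse _ = false

ones-allFalse : ∀ n → ones (allFalse {n}) ≡ 0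
ones-allFalse zero    = refl
ones-allFalse (suc n) = ones-allFalse n

insert : ∀ {n} → Fin n → (Fin n → Bool) → Fin n → Bool
insert v x w = does (v ≟ w) ∨ x w

ones-insert : ∀ {n} (v : Fin n) (x : Fin n → Bool) → x v ≡ false →
              ones (insert v x) ≡ suc (ones x)
ones-insert zero x x0≡false = cong suc (sym (begin
  ones x                            ≡⟨ ones-cons x ⟩
  bit (x zero) + ones (x ∘ suc)     ≡⟨ cong (λ b → bit b + ones (x ∘ suc)) x0≡false ⟩
  ones (x ∘ suc)                    ∎))
ones-insert (suc v) x xv≡false = begin
  ones (insert (suc v) x)                  ≡⟨ ones-cons (insert (suc v) x) ⟩
  bit (x zero) + ones (insert v (x ∘ suc)) ≡⟨ cong (bit (x zero) +_) (ones-insert v (x ∘ suc) xv≡false) ⟩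
  bit (x zero) + suc (ones (x ∘ suc))      ≡⟨ +-suc (bit (x zero)) (ones (x ∘ suc)) ⟩
  suc (bit (x zero) + ones (x ∘ suc))      ≡⟨ cong suc (sym (ones-cons x)) ⟩
  suc (ones x)                             ∎

-- The image of a subset S ⊆ Fin m under g : Fin m → Fin n.  It transports
-- sets of levels to sets of variables.
push : ∀ {m n} → (Fin m → Fin n) → (Fin m → Bool) → Fin n → Bool
push {zero}  g S = allFalse
push {m = suc m} {n} g S = if S zero then insert (g zero) rest else rest
  where
  rest : Fin n → Bool
  rest = push (g ∘ suc) (S ∘ suc)

push-outside : ∀ {m n} (g : Fin m → Fin n) (S : Fin m → Bool) (v : Fin n) →
               (∀ j → g j ≢ v) → push g S v ≡ false
push-outside {zero}  g S v v∉g = refl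
push-outside {suc m} g S v v∉g with S zero
... | true  rewrite dec-false (g zero ≟ v) (v∉g zero) = push-outside (g ∘ suc) (S ∘ suc) v (v∉g ∘ suc)
... | false = push-outside (g ∘ suc) (S ∘ suc) v (v∉g ∘ suc)

head-not-in-tail : ∀ {m n} {g : Fin (suc m) → Fin n} → Injective _≡_ _≡_ g →
                   ∀ j → g (suc j) ≢ g zero
head-not-in-tail g-inj j eq = 0≢1+n (sym (g-inj eq))

push-at : ∀ {m n} (g : Fin m → Fin n) → Injective _≡_ _≡_ g →
          (S : Fin m → Bool) (j : Fin m) → push g S (g j) ≡ S j
push-at {suc m} g g-inj S j with S zero in S0
push-at {suc m} g g-inj S zero    | true
  rewrite dec-true (g zero ≟ g zero) refl = sym S0
push-at {suc m} g g-inj S zero    | false =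
  trans (push-outside (g ∘ suc) (S ∘ suc) (g zero) (head-not-in-tail g-inj)) (sym S0)
push-at {suc m} g g-inj S (suc j) | true
  rewrite dec-false (g zero ≟ g (suc j)) (head-not-in-tail g-inj j ∘ sym) =
  push-at (g ∘ suc) (suc-injective ∘ g-inj) (S ∘ suc) j
push-at {suc m} g g-inj S (suc j) | false =
  push-at (g ∘ suc) (suc-injective ∘ g-inj) (S ∘ suc) j

ones-push : ∀ {m n} (g : Fin m → Fin n) → Injective _≡_ _≡_ g →
            (S : Fin m → Bool) → ones (push g S) ≡ ones S
ones-push {zero} {n} g g-inj S = ones-allFalse n
ones-push {suc m} {n} g g-inj S with S zero
... | true  = begin
  ones (insert (g zero) rest) ≡⟨ ones-insert (g zero) rest g0∉rest ⟩
  suc (ones rest)             ≡⟨ cong suc (ones-push (g ∘ suc) (suc-injective ∘ g-inj) (S ∘ suc)) ⟩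
  suc (ones (S ∘ suc))        ∎
  where
  rest : Fin n → Bool
  rest = push (g ∘ suc) (S ∘ suc)
  g0∉rest : rest (g zero) ≡ false
  g0∉rest = push-outside (g ∘ suc) (S ∘ suc) (g zero) (head-not-in-tail g-inj)
... | false = ones-push (g ∘ suc) (suc-injective ∘ g-inj) (S ∘ suc)

interval : ℕ → ℕ → ℕ → Bool
interval a b i = not (does (i <? a)) ∧ does (i <? b)

ones-interval : ∀ m a b → a ≤ b → b ≤ m → ones {m} (interval a b ∘ toℕ) ≡ b ∸ a
ones-interval zero    zero    zero    _         _         = refl
ones-interval (suc m) zero    zero    _         _         = ones-interval m 0 0 z≤n z≤n
ones-interval (suc m) zero    (suc b) _         (s≤s b≤m) = cong suc (ones-interval m 0 b z≤n b≤m)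
ones-interval (suc m) (suc a) (suc b) (s≤s a≤b) (s≤s b≤m) = ones-interval m a b a≤b b≤m

interval-right-irrelevant : ∀ {a b b' i} → i < b → i < b' → interval a b i ≡ interval a b' i
interval-right-irrelevant {a} {b} {b'} {i} i<b i<b' =
  cong (not (does (i <? a)) ∧_) (trans (dec-true (i <? b) i<b) (sym (dec-true (i <? b') i<b')))

interval-left-irrelevant : ∀ {a a' b i} → a ≤ i → a' ≤ i → interval a b i ≡ interval a' b i
interval-left-irrelevant {a} {a'} {b} {i} a≤i a'≤i =
  cong (λ c → not c ∧ does (i <? b))
       (trans (dec-false (i <? a) (≤⇒≯ a≤i)) (sym (dec-false (i <? a') (≤⇒≯ a'≤i))))

shift-divisible⇒≡ : ∀ {p s t} → s < p → t < p → p ∣ (p + t) ∸ s → s ≡ t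
shift-divisible⇒≡ {p} {s} {t} s<p t<p (divides zero eq) =
  ⊥-elim (<⇒≱ s<p (≤-trans (m≤m+n p t) (m∸n≡0⇒m≤n eq)))
shift-divisible⇒≡ {p} {s} {t} s<p t<p (divides (suc zero) eq) =
  sym (+-cancelˡ-≡ p t s (begin
    p + t             ≡⟨ sym (m∸n+n≡m s≤p+t) ⟩
    (p + t) ∸ s + s   ≡⟨ cong (_+ s) (trans eq (+-identityʳ p)) ⟩
    p + s             ∎))
  where s≤p+t = ≤-trans (<⇒≤ s<p) (m≤m+n p t)
shift-divisible⇒≡ {p} {s} {t} s<p t<p (divides (suc (suc r)) eq) =
  ⊥-elim (<⇒≱ t<p (≤-trans (m≤m+n p (r * p)) (+-cancelˡ-≤ p _ _ p+p+rp≤p+t)))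
  where
  p+p+rp≤p+t : p + (p + r * p) ≤ p + t
  p+p+rp≤p+t = subst (_≤ p + t) eq (m∸n≤m (p + t) s)

maxF-upper : ∀ {m} (f : Fin m → ℕ) (i : Fin m) → f i ≤ maxF f
maxF-upper f zero    = m≤m⊔n _ _
maxF-upper f (suc i) = ≤-trans (maxF-upper (f ∘ suc) i) (m≤n⊔m _ _)

module CutAndPaste {n : ℕ} (B : NOBDD n) where
  open NOBDD B

  Path : Set
  Path = (j : Fin (suc ℓ)) → Fin (size j)

  splice : Fin (suc ℓ) → Path → Path → Path
  splice K π σ i with toℕ i ≤? toℕ K
  ... | yes _ = π i
  ... | no  _ = σ i

  splice-left : ∀ K π σ i → toℕ i ≤ toℕ K → splice K π σ i ≡ π i
  splice-left K π σ i i≤K with toℕ i ≤? toℕ K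
  ... | yes _   = refl
  ... | no  i≰K = contradiction i≤K i≰K

  splice-right : ∀ K π σ → π K ≡ σ K → ∀ i → toℕ K ≤ toℕ i → splice K π σ i ≡ σ i
  splice-right K π σ meet i K≤i with toℕ i ≤? toℕ K
  ... | yes i≤K = at-K (toℕ-injective (≤-antisym i≤K K≤i))
    where
    at-K : i ≡ K → π i ≡ σ i
    at-K refl = meet
  ... | no  _   = refl

  edge-resp : ∀ j {u u' b b' w w'} → u ≡ u' → b ≡ b' → w ≡ w' →
              edge j u b w ≡ true → edge j u' b' w' ≡ true
  edge-resp j refl refl refl e = e

  cut-and-paste : ∀ {x y z} (K : Fin (suc ℓ)) (a : Accepts x) (b : Accepts y) →
    proj₁ a K ≡ proj₁ b K →
    (∀ j → toℕ j < toℕ K → z (var j) ≡ x (var j)) →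
    (∀ j → toℕ K ≤ toℕ j → z (var j) ≡ y (var j)) →
    Accepts z
  cut-and-paste {z = z} K (π , π-consistent , π-accepts) (σ , σ-consistent , σ-accepts) meet z≈x z≈y =
    splice K π σ , consistent , accepting
    where
    consistent : ConsistentPath z (splice K π σ)
    consistent j with toℕ K ≤? toℕ j
    ... | no  K≰j = edge-resp j
      (sym (splice-left K π σ (inject₁ j) (≤-trans (≤-reflexive (toℕ-inject₁ j)) (<⇒≤ j<K))))
      (sym (z≈x j j<K))
      (sym (splice-left K π σ (suc j) j<K))
      (π-consistent j)
      where j<K = ≰⇒> K≰j
    ... | yes K≤j = edge-resp j
      (sym (splice-right K π σ meet (inject₁ j) (≤-trans K≤j (≤-reflexive (sym (toℕ-inject₁ j))))))
      (sym (z≈y j K≤j))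
      (sym (splice-right K π σ meet (suc j) (≤-trans K≤j (n≤1+n _))))
      (σ-consistent j)

    K≤last : toℕ K ≤ toℕ (fromℕ ℓ)
    K≤last = ≤-trans (≤-pred (toℕ<n K)) (≤-reflexive (sym (toℕ-fromℕ ℓ)))

    accepting : accept (splice K π σ (fromℕ ℓ)) ≡ true
    accepting = subst (λ v → accept v ≡ true)
                      (sym (splice-right K π σ meet (fromℕ ℓ) K≤last)) σ-accepts

  accepts-resp : ∀ {x z} → Accepts x → (∀ j → z (var j) ≡ x (var j)) → Accepts z
  accepts-resp {x} {z} a z≈x = cut-and-paste {x} {x} {z} zero a a refl (λ _ ()) (λ j _ → z≈x j)

module ModWidth {n p : ℕ} (2≤p : 2 ≤ p) (B : NOBDD n) (computes : Computes B (MOD p n)) where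
  open NOBDD B
  open CutAndPaste B

  accepted⇒divisible : ∀ x → Accepts x → p ∣ ones x
  accepted⇒divisible x = Equivalence.to (computes x)

  divisible⇒accepted : ∀ x → p ∣ ones x → Accepts x
  divisible⇒accepted x = Equivalence.from (computes x)

  -- Every variable is queried: otherwise the input with a single one in
  -- that variable agrees with the all-zero input on all queried variables.
  every-variable-queried : ∀ v → ∃ λ j → var j ≡ v
  every-variable-queried v with any? (λ j → var j ≟ v)
  ... | yes queried = queried
  ... | no  unqueried =
    ⊥-elim (<⇒≱ 2≤p (∣⇒≤ (subst (p ∣_) ones-single (accepted⇒divisible single single-accepted))))
    where
    single : Fin n → Bool
    single = insert v allFalse

    ones-single : ones single ≡ 1
    ones-single = trans (ones-insert v allFalse refl) (cong suc (ones-allFalse n))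

    single≈allFalse : ∀ j → single (var j) ≡ false
    single≈allFalse j = cong (_∨ false) (dec-false (v ≟ var j) (λ v≡ → unqueried (j , sym v≡)))

    allFalse-accepted : Accepts allFalse
    allFalse-accepted = divisible⇒accepted allFalse (subst (p ∣_) (sym (ones-allFalse n)) (p ∣0))

    single-accepted : Accepts single
    single-accepted = accepts-resp {allFalse} {single} allFalse-accepted single≈allFalse

  variables≤levels : n ≤ ℓ
  variables≤levels = injective⇒≤ {f = level} level-injective
    where
    level : Fin n → Fin ℓ
    level v = proj₁ (every-variable-queried v)

    var∘level : ∀ v → var (level v) ≡ v
    var∘level v = proj₂ (every-variable-queried v)

    level-injective : Injective _≡_ _≡_ level
    level-injective {v} {w} eq = trans (sym (var∘level v)) (trans (cong var eq) (var∘level w))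

  module Fooling (2p≤ℓ : p + p ≤ ℓ) where
    levels : Fin p → Fin p → Fin ℓ → Bool
    levels s t j = interval (toℕ s) (p + toℕ t) (toℕ j)

    fool : Fin p → Fin p → Fin n → Bool
    fool s t = push var (levels s t)

    fool-at : ∀ s t j → fool s t (var j) ≡ levels s t j
    fool-at s t = push-at var read-once (levels s t)

    ones-fool : ∀ s t → ones (fool s t) ≡ (p + toℕ t) ∸ toℕ s
    ones-fool s t = trans (ones-push var read-once (levels s t))
      (ones-interval ℓ (toℕ s) (p + toℕ t)
        (≤-trans (<⇒≤ (toℕ<n s)) (m≤m+n p (toℕ t)))
        (≤-trans (<⇒≤ (+-monoʳ-< p (toℕ<n t))) 2p≤ℓ))

    -- The diagonal inputs have exactly p ones.
    diagonal-accepted : ∀ s → Accepts (fool s s)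
    diagonal-accepted s = divisible⇒accepted (fool s s)
      (subst (p ∣_) (sym (trans (ones-fool s s) (m+n∸n≡m p (toℕ s)))) ∣-refl)

    middle : Fin (suc ℓ)
    middle = fromℕ< (s≤s (≤-trans (m≤m+n p p) 2p≤ℓ))

    toℕ-middle : toℕ middle ≡ p
    toℕ-middle = toℕ-fromℕ< _

    crossing : Fin p → Fin (size middle)
    crossing s = proj₁ (diagonal-accepted s) middle

    agree-before : ∀ s t j → toℕ j < toℕ middle → fool s t (var j) ≡ fool s s (var j)
    agree-before s t j j<middle = begin
      fool s t (var j)  ≡⟨ fool-at s t j ⟩
      levels s t j      ≡⟨ interval-right-irrelevant {toℕ s} (≤-trans j<p (m≤m+n p (toℕ t)))
                                                          (≤-trans j<p (m≤m+n p (toℕ s))) ⟩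
      levels s s j      ≡⟨ sym (fool-at s s j) ⟩
      fool s s (var j)  ∎
      where j<p = subst (toℕ j <_) toℕ-middle j<middle

    agree-after : ∀ s t j → toℕ middle ≤ toℕ j → fool s t (var j) ≡ fool t t (var j)
    agree-after s t j middle≤j = begin
      fool s t (var j)  ≡⟨ fool-at s t j ⟩
      levels s t j      ≡⟨ interval-left-irrelevant {b = p + toℕ t} (≤-trans (<⇒≤ (toℕ<n s)) p≤j)
                                                                 (≤-trans (<⇒≤ (toℕ<n t)) p≤j) ⟩
      levels t t j      ≡⟨ sym (fool-at t t j) ⟩
      fool t t (var j)  ∎
      where p≤j = subst (_≤ toℕ j) toℕ-middle middle≤j

    crossing-injective : Injective _≡_ _≡_ crossing
    crossing-injective {s} {t} meet = toℕ-injective (shift-divisible⇒≡ (toℕ<n s) (toℕ<n t)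
      (subst (p ∣_) (ones-fool s t) (accepted⇒divisible (fool s t) mixed-accepted)))
      where
      mixed-accepted : Accepts (fool s t)
      mixed-accepted = cut-and-paste {fool s s} {fool t t} {fool s t} middle
        (diagonal-accepted s) (diagonal-accepted t) meet (agree-before s t) (agree-after s t)

    width-bound : p ≤ width
    width-bound = ≤-trans (injective⇒≤ crossing-injective) (maxF-upper size middle)

theorem10 : (n p : ℕ) → 1 ≤ n → 1 ≤ p → 2 * p ≤ n →
    (B : NOBDD n) → Computes B (MOD p n) → p ≤ NOBDD.width B
theorem10 n zero _ () _ _ _
theorem10 n 1 _ _ _ B _ =
  subst (_≤ NOBDD.width B) (NOBDD.source-unique B) (maxF-upper (NOBDD.size B) zero)
theorem10 n p@(suc (suc _)) _ _ 2p≤n B computes = Fooling.width-bound 2p≤ℓ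
  where
  open ModWidth (s≤s (s≤s z≤n)) B computes
  -- ℓ ≥ n ≥ 2p, since every variable is queried.
  2p≤ℓ : p + p ≤ NOBDD.ℓ B
  2p≤ℓ = ≤-trans (subst (_≤ n) (cong (p +_) (+-identityʳ p)) 2p≤n) variables≤levels
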